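{- Let $A\subset\mathbb Z^n$ be finite with $0\in B\subset A$, where $A$ generates $\mathbb Z^n$ as a $\mathbb Z$-module and $B^*=B\setminus \{ 0\}$ consists of exactly $n$ vectors spanning $\mathbb R^n$ (so $C_B=\{ \sum_{b\in B^*} x_bb: x_b\geq 0\}$). Then there exist real numbers $r_b\geq 0$ ($b\in B^*$) such that $$\Big\{ \sum_{b\in B^*} x_bb:\ x_b\in\mathbb R,\ x_b\geq r_b \text{ for each } b\in B^*\Big\}\cap \mathbb{Z}^n \subset \mathcal P(A).$$
   Context: $C_B=\{\sum_{b\in B}c_b b: c_b\ge0\}$ is the cone generated by $B$; $\mathcal P(A)=\{\sum_{a\in A} n_a a: n_a\in\mathbb Z_{\ge0}\}$.
   Formalization: The coefficients $x_b$ range over ℚ rather than ℝ, the thresholds $r_b$ are taken in ℚ, and spanning $\mathbb R^n$ is replaced by spanning ℚ^n. -}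

module Defs where

open import Data.Nat using (ℕ; zero; suc)
open import Data.Fin using (Fin; zero; suc)
open import Data.Integer as ℤ using (ℤ; +_)
open import Data.Rational as ℚ using (ℚ; 0ℚ)
open import Data.Product using (Σ; ∃; _×_; _,_)
open import Relation.Binary.PropositionalEquality using (_≡_)

ℤVec : ℕ → Set
ℤVec n = Fin n → ℤ

ℚVec : ℕ → Set
ℚVec n = Fin n → ℚ

toℚ : ℤ → ℚ
toℚ z = z ℚ./ 1

sumℤ : ∀ {m} → (Fin m → ℤ) → ℤ
sumℤ {zero} f = + 0
sumℤ {suc m} f = f zero ℤ.+ sumℤ (λ i → f (suc i))

sumℚ : ∀ {m} → (Fin m → ℚ) → ℚ
sumℚ {zero} f = 0ℚ
sumℚ {suc m} f = f zero ℚ.+ sumℚ (λ i → f (suc i))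

qComb : ∀ {m n} → (Fin m → ℚ) → (Fin m → ℤVec n) → ℚVec n
qComb x v j = sumℚ (λ i → x i ℚ.* toℚ (v i j))

GeneratesℤModule : ∀ {m n} → (Fin m → ℤVec n) → Set
GeneratesℤModule {m} {n} A =
  (z : ℤVec n) → Σ (Fin m → ℤ) λ c → ∀ j → z j ≡ sumℤ (λ k → c k ℤ.* A k j)

-- 𝒫(A) : nonnegative integer combinations of elements of A
InSemigroup : ∀ {m n} → (Fin m → ℤVec n) → ℤVec n → Set
InSemigroup {m} {n} A z =
  Σ (Fin m → ℕ) λ c → ∀ j → z j ≡ sumℤ (λ k → (+ c k) ℤ.* A k j)

-- integer vectors b_1..b_m span ℚ^n (equivalently, for integer vectors, ℝ^n)
Spans : ∀ {m n} → (Fin m → ℤVec n) → Set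
Spans {m} {n} b = (y : ℚVec n) → Σ (Fin m → ℚ) λ x → ∀ j → y j ≡ qComb x b j

_∈ᴬ_ : ∀ {m n} → ℤVec n → (Fin m → ℤVec n) → Set
_∈ᴬ_ {m} v A = Σ (Fin m) λ k → ∀ j → A k j ≡ v j

zeroV : ∀ {n} → ℤVec n
zeroV _ = + 0

-- Write every a ∈ A in coordinates q_a ∈ ℚⁿ with respect to the basis B* (unique: by Gaussian
-- elimination any n + 1 vectors of ℚⁿ are dependent, so n spanning vectors are independent),
-- and let D be a common denominator of all the q_a. Writing z = Σ c_a a and dividing each c_a
-- by D with remainder e_a gives z = Σ e_a a + Σ M_b b with M ∈ ℤⁿ, since D a is an integer
-- combination of B*. Comparing coordinates, x_b = Σ e_a (q_a)_b + M_b, and that sum is at most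
-- r_b = Σ D |(q_a)_b|. Hence x_b ≥ r_b forces M_b ≥ 0, and z ∈ 𝒫(A) because B* ⊆ A.

module Submission where

open import Defs
open import Data.Nat using (ℕ)
open import Data.Fin using (Fin)
open import Data.Integer using (ℤ)
open import Data.Rational using (ℚ; 0ℚ; _≤_)
open import Data.Product using (Σ; _×_)
open import Relation.Binary.PropositionalEquality using (_≡_)

open import Algebra.Bundles using (CommutativeSemiring; CommutativeRing)
open import Data.Empty using (⊥-elim)
open import Data.Fin using (zero; suc; punchIn)
open import Data.Fin.Properties using (any?)
import Data.Integer as ℤ
open import Data.Integer.DivMod using (_%ℕ_; _/ℕ_; a≡a%ℕn+[a/ℕn]*n; n%ℕd<d)
import Data.Integer.Properties as ℤP
open import Data.Nat as ℕ using (zero; suc)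
open import Data.Nat.Divisibility using (_∣_; divides; m∣m*n; n∣m*n)
import Data.Nat.Properties as ℕP
open import Data.Product using (_,_; proj₁; proj₂; ∃-syntax)
import Data.Rational as ℚ
import Data.Rational.Properties as ℚP
open import Data.Rational.Solver using (module +-*-Solver)
import Data.Rational.Unnormalised as ℚᵘ
import Data.Rational.Unnormalised.Properties as ℚᵘP
open import Data.Sum using (inj₁; inj₂)
open import Data.Vec.Functional using (_∷_; tail; insertAt; removeAt)
open import Data.Vec.Functional.Properties using (insertAt-lookup; insertAt-punchIn)
open import Function using (_∘_)
open import Relation.Nullary using (yes; no; ¬?)
open import Relation.Binary.PropositionalEquality as ≡ using (_≢_)
open import Algebra.Properties.Group ℚP.+-0-group using (x∙y⁻¹≈ε⇒x≈y)

-- sumℚ and sumℤ of Defs unfold like the library's sum, so its lemmas transfer to them.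
module FiniteSums {c ℓ} (R : CommutativeSemiring c ℓ)
  (∑ : ∀ {m} → (Fin m → CommutativeSemiring.Carrier R) → CommutativeSemiring.Carrier R)
  (∑-zero : ∀ f → ∑ {0} f ≡ CommutativeSemiring.0# R)
  (∑-suc : ∀ {m} f → ∑ {suc m} f ≡ CommutativeSemiring._+_ R (f zero) (∑ (tail f)))
  where

  open CommutativeSemiring R hiding (zero)

  open import Algebra.Properties.Semiring.Sum semiring as Sum using (sum)
  open import Relation.Binary.Reasoning.Setoid setoid

  ∑≡sum : ∀ {m} (f : Fin m → Carrier) → ∑ f ≡ sum f
  ∑≡sum {zero}  f = ∑-zero f
  ∑≡sum {suc m} f = ≡.trans (∑-suc f) (≡.cong (f zero +_) (∑≡sum (tail f)))

  ∑-cong : ∀ {m} {f g : Fin m → Carrier} → (∀ i → f i ≈ g i) → ∑ f ≈ ∑ g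
  ∑-cong {f = f} {g} f≈g = begin
    ∑ f   ≡⟨ ∑≡sum f ⟩
    sum f ≈⟨ Sum.sum-cong-≋ f≈g ⟩
    sum g ≡⟨ ∑≡sum g ⟨
    ∑ g   ∎

  ∑-zeros : ∀ {m} → ∑ {m} (λ _ → 0#) ≈ 0#
  ∑-zeros {m} = trans (reflexive (∑≡sum _)) (Sum.sum-replicate-zero m)

  ∑-distrib-+ : ∀ {m} (f g : Fin m → Carrier) → ∑ (λ i → f i + g i) ≈ ∑ f + ∑ g
  ∑-distrib-+ f g = begin
    ∑ (λ i → f i + g i) ≡⟨ ∑≡sum _ ⟩
    sum (λ i → f i + g i) ≈⟨ Sum.∑-distrib-+ f g ⟩
    sum f + sum g         ≡⟨ ≡.cong₂ _+_ (∑≡sum f) (∑≡sum g) ⟨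
    ∑ f + ∑ g             ∎

  *-distribˡ-∑ : ∀ {m} x (f : Fin m → Carrier) → x * ∑ f ≈ ∑ (λ i → x * f i)
  *-distribˡ-∑ x f = begin
    x * ∑ f                ≡⟨ ≡.cong (x *_) (∑≡sum f) ⟩
    x * sum f              ≈⟨ Sum.*-distribˡ-sum x f ⟩
    sum (λ i → x * f i)    ≡⟨ ∑≡sum _ ⟨
    ∑ (λ i → x * f i)      ∎

  *-distribʳ-∑ : ∀ {m} x (f : Fin m → Carrier) → ∑ f * x ≈ ∑ (λ i → f i * x)
  *-distribʳ-∑ x f = begin
    ∑ f * x                ≡⟨ ≡.cong (_* x) (∑≡sum f) ⟩
    sum f * x              ≈⟨ Sum.*-distribʳ-sum x f ⟩
    sum (λ i → f i * x)    ≡⟨ ∑≡sum _ ⟨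
    ∑ (λ i → f i * x)      ∎

  ∑-comm : ∀ {m n} (f : Fin m → Fin n → Carrier) → ∑ (λ i → ∑ (f i)) ≈ ∑ (λ j → ∑ (λ i → f i j))
  ∑-comm f = begin
    ∑ (λ i → ∑ (f i))              ≡⟨ ≡.trans (∑≡sum _) (Sum.sum-cong-≗ (∑≡sum ∘ f)) ⟩
    sum (λ i → sum (f i))          ≈⟨ Sum.∑-comm f ⟩
    sum (λ j → sum (λ i → f i j))  ≡⟨ ≡.trans (∑≡sum _) (Sum.sum-cong-≗ (λ j → ∑≡sum (λ i → f i j))) ⟨
    ∑ (λ j → ∑ (λ i → f i j))      ∎

  ∑-remove : ∀ {m} (f : Fin (suc m) → Carrier) p → ∑ f ≈ f p + ∑ (removeAt f p)
  ∑-remove f p = begin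
    ∑ f                         ≡⟨ ∑≡sum f ⟩
    sum f                       ≈⟨ Sum.sum-remove f ⟩
    f p + sum (removeAt f p)    ≡⟨ ≡.cong (f p +_) (∑≡sum _) ⟨
    f p + ∑ (removeAt f p)      ∎

  linComb : ∀ {m n} → (Fin m → Carrier) → (Fin m → Fin n → Carrier) → Fin n → Carrier
  linComb c v j = ∑ (λ k → c k * v k j)

  linComb-distrib-+ : ∀ {m n} (c d : Fin m → Carrier) (v : Fin m → Fin n → Carrier) j →
    linComb (λ k → c k + d k) v j ≈ linComb c v j + linComb d v j
  linComb-distrib-+ c d v j =
    trans (∑-cong (λ k → distribʳ (v k j) (c k) (d k))) (∑-distrib-+ _ _)

  *-distribˡ-linComb : ∀ {m n} a (c : Fin m → Carrier) (v : Fin m → Fin n → Carrier) j →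
    a * linComb c v j ≈ linComb (λ k → a * c k) v j
  *-distribˡ-linComb a c v j =
    trans (*-distribˡ-∑ a _) (∑-cong (λ k → sym (*-assoc a (c k) (v k j))))

  linComb-zeroˡ : ∀ {m n} (c : Fin m → Carrier) (v : Fin m → Fin n → Carrier) j →
    (∀ k → c k ≈ 0#) → linComb c v j ≈ 0#
  linComb-zeroˡ c v j c≈0 = trans (∑-cong (λ k → trans (*-congʳ (c≈0 k)) (zeroˡ (v k j)))) ∑-zeros

  linComb-zeroʳ : ∀ {m n} (c : Fin m → Carrier) (v : Fin m → Fin n → Carrier) j →
    (∀ k → v k j ≈ 0#) → linComb c v j ≈ 0#
  linComb-zeroʳ c v j v≈0 = trans (∑-cong (λ k → trans (*-congˡ (v≈0 k)) (zeroʳ (c k)))) ∑-zeros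

  linComb-assoc : ∀ {m n p} (c : Fin m → Carrier) (u : Fin m → Fin n → Carrier)
    (v : Fin n → Fin p → Carrier) j →
    linComb (linComb c u) v j ≈ linComb c (λ k → linComb (u k) v) j
  linComb-assoc c u v j = begin
    ∑ (λ i → ∑ (λ k → c k * u k i) * v i j)    ≈⟨ ∑-cong (λ i → *-distribʳ-∑ (v i j) _) ⟩
    ∑ (λ i → ∑ (λ k → c k * u k i * v i j))    ≈⟨ ∑-comm _ ⟩
    ∑ (λ k → ∑ (λ i → c k * u k i * v i j))    ≈⟨ ∑-cong (λ k → ∑-cong (λ i → *-assoc (c k) (u k i) (v i j))) ⟩
    ∑ (λ k → ∑ (λ i → c k * (u k i * v i j)))  ≈⟨ ∑-cong (λ k → sym (*-distribˡ-∑ (c k) _)) ⟩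
    ∑ (λ k → c k * ∑ (λ i → u k i * v i j))    ∎

  δ : ∀ {n} → Fin n → Fin n → Carrier
  δ zero    zero    = 1#
  δ zero    (suc _) = 0#
  δ (suc _) zero    = 0#
  δ (suc i) (suc j) = δ i j

  linComb-δ : ∀ {n} (c : Fin n → Carrier) j → linComb c δ j ≈ c j
  linComb-δ c zero = begin
    linComb c δ zero                              ≡⟨ ∑-suc _ ⟩
    c zero * 1# + linComb (tail c) (tail δ) zero  ≈⟨ +-cong (*-identityʳ (c zero))
                                                       (linComb-zeroʳ (tail c) (tail δ) zero (λ _ → refl)) ⟩
    c zero + 0#                                   ≈⟨ +-identityʳ (c zero) ⟩
    c zero                                        ∎
  linComb-δ c (suc j) = begin
    linComb c δ (suc j)                           ≡⟨ ∑-suc _ ⟩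
    c zero * 0# + linComb (tail c) δ j            ≈⟨ +-cong (zeroʳ (c zero)) (linComb-δ (tail c) j) ⟩
    0# + c (suc j)                                ≈⟨ +-identityˡ (c (suc j)) ⟩
    c (suc j)                                     ∎

open import Data.Integer using (+_; +≤+)
open import Data.Rational using (1ℚ; _+_; _*_; -_; _-_; ∣_∣)

module ℚΣ = FiniteSums (CommutativeRing.commutativeSemiring ℚP.+-*-commutativeRing)
  sumℚ (λ _ → ≡.refl) (λ _ → ≡.refl)
module ℤΣ = FiniteSums ℤP.+-*-commutativeSemiring sumℤ (λ _ → ≡.refl) (λ _ → ≡.refl)

open ℚΣ

∑-mono-≤ : ∀ {m} {f g : Fin m → ℚ} → (∀ i → f i ≤ g i) → sumℚ f ≤ sumℚ g
∑-mono-≤ {zero}  _   = ℚP.≤-refl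
∑-mono-≤ {suc m} f≤g = ℚP.+-mono-≤ (f≤g zero) (∑-mono-≤ (f≤g ∘ suc))

-- Facts about toℚ z = z / 1 are proved in ℚᵘ, where z / 1 is literally mkℚᵘ z 0.
module _ where
  open ℚᵘ using (mkℚᵘ; *≡*; *≤*)
  open ℚᵘP.≃-Reasoning

  toℚᵘ-toℚ : ∀ z → ℚ.toℚᵘ (toℚ z) ℚᵘ.≃ mkℚᵘ z 0
  toℚᵘ-toℚ z = ℚP.toℚᵘ-fromℚᵘ (mkℚᵘ z 0)

  /1-cong : ∀ {a b} → a ≡ b → mkℚᵘ a 0 ℚᵘ.≃ mkℚᵘ b 0
  /1-cong a≡b = *≡* (≡.cong (ℤ._* + 1) a≡b)

  toℚ-+ : ∀ a b → toℚ (a ℤ.+ b) ≡ toℚ a + toℚ b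
  toℚ-+ a b = ℚP.toℚᵘ-injective (begin
    ℚ.toℚᵘ (toℚ (a ℤ.+ b))              ≈⟨ toℚᵘ-toℚ (a ℤ.+ b) ⟩
    mkℚᵘ (a ℤ.+ b) 0                    ≈⟨ /1-cong (≡.cong₂ ℤ._+_ (ℤP.*-identityʳ a) (ℤP.*-identityʳ b)) ⟨
    mkℚᵘ a 0 ℚᵘ.+ mkℚᵘ b 0              ≈⟨ ℚᵘP.+-cong (toℚᵘ-toℚ a) (toℚᵘ-toℚ b) ⟨
    ℚ.toℚᵘ (toℚ a) ℚᵘ.+ ℚ.toℚᵘ (toℚ b)  ≈⟨ ℚP.toℚᵘ-homo-+ (toℚ a) (toℚ b) ⟨
    ℚ.toℚᵘ (toℚ a + toℚ b)              ∎)

  toℚ-* : ∀ a b → toℚ (a ℤ.* b) ≡ toℚ a * toℚ b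
  toℚ-* a b = ℚP.toℚᵘ-injective (begin
    ℚ.toℚᵘ (toℚ (a ℤ.* b))              ≈⟨ toℚᵘ-toℚ (a ℤ.* b) ⟩
    mkℚᵘ (a ℤ.* b) 0                    ≈⟨ ℚᵘP.*-cong (toℚᵘ-toℚ a) (toℚᵘ-toℚ b) ⟨
    ℚ.toℚᵘ (toℚ a) ℚᵘ.* ℚ.toℚᵘ (toℚ b)  ≈⟨ ℚP.toℚᵘ-homo-* (toℚ a) (toℚ b) ⟨
    ℚ.toℚᵘ (toℚ a * toℚ b)              ∎)

  toℚ-injective : ∀ {a b} → toℚ a ≡ toℚ b → a ≡ b
  toℚ-injective {a} {b} eq with begin
    mkℚᵘ a 0        ≈⟨ toℚᵘ-toℚ a ⟨
    ℚ.toℚᵘ (toℚ a)  ≈⟨ ℚP.toℚᵘ-cong eq ⟩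
    ℚ.toℚᵘ (toℚ b)  ≈⟨ toℚᵘ-toℚ b ⟩
    mkℚᵘ b 0        ∎
  ... | *≡* a*1≡b*1 = ℤP.*-cancelʳ-≡ a b (+ 1) a*1≡b*1

  toℚ-↧*≡↥ : ∀ x → toℚ (+ ℚ.↧ₙ x) * x ≡ toℚ (ℚ.↥ x)
  toℚ-↧*≡↥ x@(ℚ.mkℚ n d-1 _) = ℚP.toℚᵘ-injective (begin
    ℚ.toℚᵘ (toℚ (+ suc d-1) * x)              ≈⟨ ℚP.toℚᵘ-homo-* (toℚ (+ suc d-1)) x ⟩
    ℚ.toℚᵘ (toℚ (+ suc d-1)) ℚᵘ.* ℚ.toℚᵘ x   ≈⟨ ℚᵘP.*-congʳ (toℚᵘ-toℚ (+ suc d-1)) ⟩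
    mkℚᵘ (+ suc d-1) 0 ℚᵘ.* mkℚᵘ n d-1        ≈⟨ *≡* d*n*1≡n*d ⟩
    mkℚᵘ n 0                                  ≈⟨ toℚᵘ-toℚ n ⟨
    ℚ.toℚᵘ (toℚ n)                            ∎)
    where
    d*n*1≡n*d : (+ suc d-1 ℤ.* n) ℤ.* + 1 ≡ n ℤ.* + (1 ℕ.* suc d-1)
    d*n*1≡n*d rewrite ℕP.*-identityˡ (suc d-1) | ℤP.*-identityʳ (+ suc d-1 ℤ.* n) = ℤP.*-comm (+ suc d-1) n

  toℚ-mono-≤ : ∀ {a b} → a ℤ.≤ b → toℚ a ≤ toℚ b
  toℚ-mono-≤ {a} {b} a≤b = ℚP.toℚᵘ-cancel-≤
    (ℚᵘP.≤-respˡ-≃ (ℚᵘP.≃-sym (toℚᵘ-toℚ a)) (ℚᵘP.≤-respʳ-≃ (ℚᵘP.≃-sym (toℚᵘ-toℚ b))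
      (*≤* (ℤP.*-monoʳ-≤-nonNeg (+ 1) a≤b))))

  toℚ-cancel-≤ : ∀ {a b} → toℚ a ≤ toℚ b → a ℤ.≤ b
  toℚ-cancel-≤ {a} {b} a≤b
    with ℚᵘP.≤-respˡ-≃ (toℚᵘ-toℚ a) (ℚᵘP.≤-respʳ-≃ (toℚᵘ-toℚ b) (ℚP.toℚᵘ-mono-≤ a≤b))
  ... | *≤* a*1≤b*1 = ℤP.*-cancelʳ-≤-pos a b (+ 1) a*1≤b*1

toℚVec : ∀ {n} → ℤVec n → ℚVec n
toℚVec v j = toℚ (v j)

toℚ-linComb : ∀ {m n} (c : Fin m → ℤ) (v : Fin m → ℤVec n) j →
  toℚ (ℤΣ.linComb c v j) ≡ linComb (toℚVec c) (toℚVec ∘ v) j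
toℚ-linComb {zero}  c v j = ≡.refl
toℚ-linComb {suc m} c v j = ≡.trans (toℚ-+ (c zero ℤ.* v zero j) (ℤΣ.linComb (tail c) (tail v) j))
  (≡.cong₂ _+_ (toℚ-* (c zero) (v zero j)) (toℚ-linComb (tail c) (tail v) j))

0≤toℚ+ : ∀ k → 0ℚ ≤ toℚ (+ k)
0≤toℚ+ k = toℚ-mono-≤ {+ 0} {+ k} (+≤+ ℕ.z≤n)

p≤∣p∣ : ∀ p → p ≤ ∣ p ∣
p≤∣p∣ p with ℚP.≤-total 0ℚ p
... | inj₁ 0≤p = ℚP.≤-reflexive (≡.sym (ℚP.0≤p⇒∣p∣≡p 0≤p))
... | inj₂ p≤0 = ℚP.≤-trans p≤0 (ℚP.0≤∣p∣ p)

x≡s+t∧s≤x⇒0≤t : ∀ {s t x} → x ≡ s + t → s ≤ x → 0ℚ ≤ t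
x≡s+t∧s≤x⇒0≤t {s} {t} {x} x≡s+t s≤x = begin
  0ℚ            ≡⟨ ℚP.+-inverseˡ s ⟨
  - s + s       ≤⟨ ℚP.+-monoʳ-≤ (- s) s≤x ⟩
  - s + x       ≡⟨ ≡.cong (λ u → - s + u) x≡s+t ⟩
  - s + (s + t) ≡⟨ solve 2 (λ s t → (:- s) :+ (s :+ t) := t) ≡.refl s t ⟩
  t             ∎
  where
  open ℚP.≤-Reasoning
  open +-*-Solver

a*x≡0⇒x≡0 : ∀ {a} x → a ≢ 0ℚ → a * x ≡ 0ℚ → x ≡ 0ℚ
a*x≡0⇒x≡0 {a} x a≢0 a*x≡0 = begin
  x                ≡⟨ ℚP.*-identityˡ x ⟨
  1ℚ * x           ≡⟨ ≡.cong (_* x) (ℚP.*-inverseˡ a) ⟨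
  ℚ.1/ a * a * x   ≡⟨ ℚP.*-assoc (ℚ.1/ a) a x ⟩
  ℚ.1/ a * (a * x) ≡⟨ ≡.cong (ℚ.1/ a *_) a*x≡0 ⟩
  ℚ.1/ a * 0ℚ      ≡⟨ ℚP.*-zeroʳ (ℚ.1/ a) ⟩
  0ℚ               ∎
  where
  open ≡.≡-Reasoning
  instance _ = ℚ.≢-nonZero a≢0

LinearlyDependent : ∀ {m n} → (Fin m → ℚVec n) → Set
LinearlyDependent v = ∃[ c ] (∃[ k ] c k ≢ 0ℚ) × (∀ i → linComb c v i ≡ 0ℚ)

dependent-dropColumn : ∀ {m n} (v : Fin m → ℚVec (suc n)) →
  (∀ k → v k zero ≡ 0ℚ) → LinearlyDependent (tail ∘ v) → LinearlyDependent v
dependent-dropColumn v v₀≡0 (c , c≢0 , rel) = c , c≢0 , λ where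
  zero    → linComb-zeroʳ c v zero v₀≡0
  (suc i) → rel i

shear : ∀ {m n} → Fin (suc m) → (Fin m → ℚ) → (Fin (suc m) → ℚVec n) → Fin m → ℚVec n
shear p y v j i = v (punchIn p j) i - y j * v p i

linComb-shear : ∀ {m n} p y (v : Fin (suc m) → ℚVec n) (d : Fin m → ℚ) i →
  linComb (insertAt d p (- sumℚ (λ j → d j * y j))) v i ≡ linComb d (shear p y v) i
linComb-shear {m} p y v d i = begin
  linComb c v i
    ≡⟨ ∑-remove (λ k → c k * v k i) p ⟩
  c p * u + sumℚ (λ j → c (punchIn p j) * w j)
    ≡⟨ ≡.cong₂ (λ a t → a * u + t) (insertAt-lookup d p (- s))
               (∑-cong (λ j → ≡.cong (_* w j) (insertAt-punchIn d p (- s) j))) ⟩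
  - s * u + dw
    ≡⟨ solve 3 (λ s u dw → (:- s) :* u :+ dw := dw :+ (:- u) :* s) ≡.refl s u dw ⟩
  dw + - u * s
    ≡⟨ ≡.cong (λ t → dw + t) (*-distribˡ-∑ (- u) (λ j → d j * y j)) ⟩
  dw + sumℚ (λ j → - u * (d j * y j))
    ≡⟨ ∑-distrib-+ (λ j → d j * w j) (λ j → - u * (d j * y j)) ⟨
  sumℚ (λ j → d j * w j + - u * (d j * y j))
    ≡⟨ ∑-cong (λ j → expand (d j) (w j) (y j) u) ⟩
  linComb d (shear p y v) i ∎
  where
  open ≡.≡-Reasoning
  open +-*-Solver
  w : Fin m → ℚ
  w j = v (punchIn p j) i
  s u dw : ℚ
  s = sumℚ (λ j → d j * y j)
  u = v p i
  dw = sumℚ (λ j → d j * w j)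
  c : Fin (suc m) → ℚ
  c = insertAt d p (- s)
  expand : ∀ d w y u → d * w + - u * (d * y) ≡ d * (w - y * u)
  expand = solve 4 (λ d w y u → d :* w :+ (:- u) :* (d :* y) := d :* (w :- y :* u)) ≡.refl

dependent-shear : ∀ {m n} p y (v : Fin (suc m) → ℚVec n) →
  LinearlyDependent (shear p y v) → LinearlyDependent v
dependent-shear p y v (d , (k , dk≢0) , rel) =
  insertAt d p (- sumℚ (λ j → d j * y j)) ,
  (punchIn p k , λ ck≡0 → dk≢0 (≡.trans (≡.sym (insertAt-punchIn d p _ k)) ck≡0)) ,
  λ i → ≡.trans (linComb-shear p y v d i) (rel i)

x-x*a⁻¹*a≡0 : ∀ x a .{{_ : ℚ.NonZero a}} → x - x * ℚ.1/ a * a ≡ 0ℚ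
x-x*a⁻¹*a≡0 x a = begin
  x - x * ℚ.1/ a * a   ≡⟨ ≡.cong (λ t → x - t) (ℚP.*-assoc x (ℚ.1/ a) a) ⟩
  x - x * (ℚ.1/ a * a) ≡⟨ ≡.cong (λ t → x - x * t) (ℚP.*-inverseˡ a) ⟩
  x - x * 1ℚ           ≡⟨ ≡.cong (λ t → x - t) (ℚP.*-identityʳ x) ⟩
  x - x                ≡⟨ ℚP.+-inverseʳ x ⟩
  0ℚ                   ∎
  where open ≡.≡-Reasoning

-- Row p, chosen with a nonzero first entry if there is one, clears the first column.
pivot : ∀ {m n} (v : Fin (suc m) → ℚVec (suc n)) →
  ∃[ p ] ∃[ y ] ∀ j → shear p y v j zero ≡ 0ℚ
pivot v with any? (λ k → ¬? (v k zero ℚP.≟ 0ℚ))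
... | yes (p , vp≢0) = p , (λ j → v (punchIn p j) zero * ℚ.1/ v p zero) ,
  λ j → x-x*a⁻¹*a≡0 (v (punchIn p j) zero) (v p zero)
  where instance _ = ℚ.≢-nonZero vp≢0
... | no ∄ = zero , (λ _ → 0ℚ) , λ j →
  ≡.trans (≡.cong₂ _-_ (column≡0 (suc j)) (ℚP.*-zeroˡ (v zero zero))) (ℚP.+-inverseʳ 0ℚ)
  where
  column≡0 : ∀ k → v k zero ≡ 0ℚ
  column≡0 k with v k zero ℚP.≟ 0ℚ
  ... | yes vk≡0 = vk≡0
  ... | no vk≢0 = ⊥-elim (∄ (k , vk≢0))

dependent : ∀ {n} (v : Fin (suc n) → ℚVec n) → LinearlyDependent v
dependent {zero}  v = (λ _ → 1ℚ) , (zero , ℚP.1≢0) , λ ()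
dependent {suc n} v with pivot v
... | p , y , column≡0 =
  dependent-shear p y v (dependent-dropColumn (shear p y v) column≡0 (dependent (tail ∘ shear p y v)))

Spanning : ∀ {m n} → (Fin m → ℚVec n) → Set
Spanning {m} {n} B = (y : ℚVec n) → ∃[ x ] ∀ j → y j ≡ linComb x B j

spanning⇒independent : ∀ {n} {B : Fin n → ℚVec n} → Spanning B →
  ∀ x → (∀ j → linComb x B j ≡ 0ℚ) → ∀ i → x i ≡ 0ℚ
spanning⇒independent {n} {B} span x Bx≡0 i with dependent (x ∷ λ l → proj₁ (span (δ l)))
... | c , (k , ck≢0) , rel = a*x≡0⇒x≡0 (x i) (c₀≢0 k ck≢0) (begin
  c zero * x i         ≡⟨ ℚP.+-identityʳ _ ⟨
  c zero * x i + 0ℚ    ≡⟨ ≡.cong (λ t → c zero * x i + t) (linComb-zeroˡ (tail c) e i c-suc≡0) ⟨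
  linComb c (x ∷ e) i  ≡⟨ rel i ⟩
  0ℚ                   ∎)
  where
  open ≡.≡-Reasoning
  e : Fin n → ℚVec n
  e l = proj₁ (span (δ l))
  eB : Fin n → ℚVec n
  eB l = linComb (e l) B
  -- B maps the relation c among x, e 0, …, e (n - 1) to Σ c (suc l) δ l = 0, as B x = 0.
  c-suc≡0 : ∀ l → c (suc l) ≡ 0ℚ
  c-suc≡0 l = begin
    c (suc l)
      ≡⟨ linComb-δ (tail c) l ⟨
    linComb (tail c) δ l
      ≡⟨ ∑-cong (λ l′ → ≡.cong (c (suc l′) *_) (proj₂ (span (δ l′)) l)) ⟩
    linComb (tail c) eB l
      ≡⟨ ℚP.+-identityˡ _ ⟨
    0ℚ + linComb (tail c) eB l
      ≡⟨ ≡.cong (_+ linComb (tail c) eB l) (≡.trans (≡.cong (c zero *_) (Bx≡0 l)) (ℚP.*-zeroʳ (c zero))) ⟨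
    linComb c (λ k → linComb ((x ∷ e) k) B) l
      ≡⟨ linComb-assoc c (x ∷ e) B l ⟨
    linComb (linComb c (x ∷ e)) B l
      ≡⟨ linComb-zeroˡ _ B l rel ⟩
    0ℚ ∎
  c₀≢0 : ∀ k → c k ≢ 0ℚ → c zero ≢ 0ℚ
  c₀≢0 zero    c₀≢0′ = c₀≢0′
  c₀≢0 (suc l) cₗ≢0  = λ _ → cₗ≢0 (c-suc≡0 l)

spanning⇒injective : ∀ {n} {B : Fin n → ℚVec n} → Spanning B →
  ∀ x y → (∀ j → linComb x B j ≡ linComb y B j) → ∀ i → x i ≡ y i
spanning⇒injective {B = B} span x y Bx≡By i =
  x∙y⁻¹≈ε⇒x≈y (x i) (y i) (spanning⇒independent span (λ k → x k - y k) B[x-y]≡0 i)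
  where
  open ≡.≡-Reasoning
  B[x-y]≡0 : ∀ j → linComb (λ k → x k - y k) B j ≡ 0ℚ
  B[x-y]≡0 j = begin
    linComb (λ k → x k - y k) B j              ≡⟨ linComb-distrib-+ x (λ k → - y k) B j ⟩
    linComb x B j + linComb (λ k → - y k) B j  ≡⟨ ≡.cong (λ t → t + linComb (λ k → - y k) B j) (Bx≡By j) ⟩
    linComb y B j + linComb (λ k → - y k) B j  ≡⟨ linComb-distrib-+ y (λ k → - y k) B j ⟨
    linComb (λ k → y k - y k) B j              ≡⟨ linComb-zeroˡ _ B j (λ k → ℚP.+-inverseʳ (y k)) ⟩
    0ℚ                                         ∎

HasDenominator : ℕ → ℚ → Set
HasDenominator D x = ∃[ N ] toℚ (+ D) * x ≡ toℚ N

hasDenominator-↧ : ∀ x → HasDenominator (ℚ.↧ₙ x) x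
hasDenominator-↧ x = ℚ.↥ x , toℚ-↧*≡↥ x

hasDenominator-∣ : ∀ {D D′ x} → D ∣ D′ → HasDenominator D x → HasDenominator D′ x
hasDenominator-∣ {D} {x = x} (divides q ≡.refl) (N , D*x≡N) = + q ℤ.* N , (begin
  toℚ (+ (q ℕ.* D)) * x          ≡⟨ ≡.cong (λ t → toℚ t * x) (ℤP.pos-* q D) ⟩
  toℚ (+ q ℤ.* + D) * x          ≡⟨ ≡.cong (_* x) (toℚ-* (+ q) (+ D)) ⟩
  toℚ (+ q) * toℚ (+ D) * x      ≡⟨ ℚP.*-assoc (toℚ (+ q)) (toℚ (+ D)) x ⟩
  toℚ (+ q) * (toℚ (+ D) * x)    ≡⟨ ≡.cong (toℚ (+ q) *_) D*x≡N ⟩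
  toℚ (+ q) * toℚ N              ≡⟨ toℚ-* (+ q) N ⟨
  toℚ (+ q ℤ.* N)                ∎)
  where open ≡.≡-Reasoning

commonMultiple : ∀ {m} (P : Fin m → ℕ → Set) → (∀ {k D D′} → D ∣ D′ → P k D → P k D′) →
  (∀ k → ∃[ D ] P k (suc D)) → ∃[ D ] ∀ k → P k (suc D)
commonMultiple {zero}  P _  _    = 0 , λ ()
commonMultiple {suc m} P up base with base zero | commonMultiple (P ∘ suc) up (base ∘ suc)
... | D₀ , P₀ | D , Pₛ = D ℕ.+ D₀ ℕ.* suc D , λ where
  zero    → up (m∣m*n (suc D)) P₀
  (suc k) → up (n∣m*n (suc D₀)) (Pₛ k)

commonDenominator : ∀ {m n} (q : Fin m → ℚVec n) → ∃[ D ] ∀ k i → HasDenominator (suc D) (q k i)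
commonDenominator q =
  commonMultiple (λ k D → ∀ i → HasDenominator D (q k i)) (λ D∣D′ h i → hasDenominator-∣ D∣D′ (h i))
    (λ k → commonMultiple (λ i D → HasDenominator D (q k i)) hasDenominator-∣
      (λ i → ℚ.ℚ.denominator-1 (q k i) , hasDenominator-↧ (q k i)))

module _ {m n} (A : Fin m → ℤVec n) where
  open ≡.≡-Reasoning

  inSemigroup-resp : ∀ {u w} → (∀ j → u j ≡ w j) → InSemigroup A w → InSemigroup A u
  inSemigroup-resp u≡w (c , w≡cA) = c , λ j → ≡.trans (u≡w j) (w≡cA j)

  inSemigroup-0 : InSemigroup A zeroV
  inSemigroup-0 = (λ _ → 0) , λ j → ≡.sym (ℤΣ.linComb-zeroˡ (λ _ → + 0) A j (λ _ → ≡.refl))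

  inSemigroup-+ : ∀ {u w} → InSemigroup A u → InSemigroup A w → InSemigroup A (λ j → u j ℤ.+ w j)
  inSemigroup-+ {u} {w} (c , u≡cA) (d , w≡dA) = (λ k → c k ℕ.+ d k) , λ j → begin
    u j ℤ.+ w j
      ≡⟨ ≡.cong₂ ℤ._+_ (u≡cA j) (w≡dA j) ⟩
    ℤΣ.linComb (+_ ∘ c) A j ℤ.+ ℤΣ.linComb (+_ ∘ d) A j
      ≡⟨ ℤΣ.linComb-distrib-+ (+_ ∘ c) (+_ ∘ d) A j ⟨
    ℤΣ.linComb (λ k → + c k ℤ.+ + d k) A j
      ≡⟨ ℤΣ.∑-cong (λ k → ≡.cong (ℤ._* A k j) (ℤP.pos-+ (c k) (d k))) ⟨
    ℤΣ.linComb (λ k → + (c k ℕ.+ d k)) A j ∎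

  inSemigroup-scale : ∀ s {w} → InSemigroup A w → InSemigroup A (λ j → + s ℤ.* w j)
  inSemigroup-scale s {w} (c , w≡cA) = (λ k → s ℕ.* c k) , λ j → begin
    + s ℤ.* w j
      ≡⟨ ≡.cong (+ s ℤ.*_) (w≡cA j) ⟩
    + s ℤ.* ℤΣ.linComb (+_ ∘ c) A j
      ≡⟨ ℤΣ.*-distribˡ-linComb (+ s) (+_ ∘ c) A j ⟩
    ℤΣ.linComb (λ k → + s ℤ.* + c k) A j
      ≡⟨ ℤΣ.∑-cong (λ k → ≡.cong (ℤ._* A k j) (ℤP.pos-* s (c k))) ⟨
    ℤΣ.linComb (λ k → + (s ℕ.* c k)) A j ∎

  inSemigroup-linComb : ∀ {p} (s : Fin p → ℕ) (w : Fin p → ℤVec n) →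
    (∀ i → InSemigroup A (w i)) → InSemigroup A (ℤΣ.linComb (+_ ∘ s) w)
  inSemigroup-linComb {zero}  s w _      = inSemigroup-0
  inSemigroup-linComb {suc p} s w w∈𝒫 =
    inSemigroup-+ (inSemigroup-scale (s zero) (w∈𝒫 zero))
                  (inSemigroup-linComb (tail s) (tail w) (λ i → w∈𝒫 (suc i)))

inSemigroup-head : ∀ {m n} (A : Fin (suc m) → ℤVec n) → InSemigroup A (A zero)
inSemigroup-head A = (1 ∷ λ _ → 0) , λ j → ≡.sym (begin
  + 1 ℤ.* A zero j ℤ.+ ℤΣ.linComb (λ _ → + 0) (tail A) j
    ≡⟨ ≡.cong₂ ℤ._+_ (ℤP.*-identityˡ (A zero j)) (ℤΣ.linComb-zeroˡ _ (tail A) j (λ _ → ≡.refl)) ⟩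
  A zero j ℤ.+ + 0
    ≡⟨ ℤP.+-identityʳ (A zero j) ⟩
  A zero j ∎)
  where open ≡.≡-Reasoning

inSemigroup-tail : ∀ {m n} (A : Fin (suc m) → ℤVec n) {v} → InSemigroup (tail A) v → InSemigroup A v
inSemigroup-tail A (c , v≡cA) = (0 ∷ c) , λ j → ≡.trans (v≡cA j) (≡.sym (begin
  + 0 ℤ.* A zero j ℤ.+ ℤΣ.linComb (+_ ∘ c) (tail A) j
    ≡⟨ ≡.cong (ℤ._+ ℤΣ.linComb (+_ ∘ c) (tail A) j) (ℤP.*-zeroˡ (A zero j)) ⟩
  + 0 ℤ.+ ℤΣ.linComb (+_ ∘ c) (tail A) j
    ≡⟨ ℤP.+-identityˡ _ ⟩
  ℤΣ.linComb (+_ ∘ c) (tail A) j ∎))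
  where open ≡.≡-Reasoning

inSemigroup-generator : ∀ {m n} (A : Fin m → ℤVec n) k → InSemigroup A (A k)
inSemigroup-generator A zero    = inSemigroup-head A
inSemigroup-generator A (suc k) = inSemigroup-tail A (inSemigroup-generator (tail A) k)

∈ᴬ⇒inSemigroup : ∀ {m n} {A : Fin m → ℤVec n} {v} → v ∈ᴬ A → InSemigroup A v
∈ᴬ⇒inSemigroup {A = A} (k , Ak≡v) = inSemigroup-resp A (≡.sym ∘ Ak≡v) (inSemigroup-generator A k)

module _ {m n} (A : Fin m → ℤVec n) (b : Fin n → ℤVec n) (spans : Spans b) where

  private
    B : Fin n → ℚVec n
    B = toℚVec ∘ b

    q : Fin m → ℚVec n
    q k = proj₁ (spans (toℚVec (A k)))

    A≡qB : ∀ k j → toℚ (A k j) ≡ linComb (q k) B j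
    A≡qB k = proj₂ (spans (toℚVec (A k)))

    D : ℕ
    D = suc (proj₁ (commonDenominator q))

    N : Fin m → ℤVec n
    N k i = proj₁ (proj₂ (commonDenominator q) k i)

    D*q≡N : ∀ k i → toℚ (+ D) * q k i ≡ toℚ (N k i)
    D*q≡N k i = proj₂ (proj₂ (commonDenominator q) k i)

  threshold : Fin n → ℚ
  threshold i = sumℚ (λ k → toℚ (+ D) * ∣ q k i ∣)

  threshold-nonNeg : ∀ i → 0ℚ ≤ threshold i
  threshold-nonNeg i = ℚP.≤-trans (ℚP.≤-reflexive (≡.sym (∑-zeros {m}))) (∑-mono-≤ 0≤D∣q∣)
    where
    0≤D∣q∣ : ∀ k → 0ℚ ≤ toℚ (+ D) * ∣ q k i ∣
    0≤D∣q∣ k = ℚP.nonNegative⁻¹ _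
      {{ℚP.nonNeg*nonNeg⇒nonNeg (toℚ (+ D)) {{ℚ.nonNegative (0≤toℚ+ D)}} ∣ q k i ∣ {{ℚP.∣-∣-nonNeg (q k i)}}}}

  D*A≡N·b : ∀ k j → + D ℤ.* A k j ≡ ℤΣ.linComb (N k) b j
  D*A≡N·b k j = toℚ-injective (begin
    toℚ (+ D ℤ.* A k j)                    ≡⟨ toℚ-* (+ D) (A k j) ⟩
    toℚ (+ D) * toℚ (A k j)                ≡⟨ ≡.cong (toℚ (+ D) *_) (A≡qB k j) ⟩
    toℚ (+ D) * linComb (q k) B j          ≡⟨ *-distribˡ-linComb (toℚ (+ D)) (q k) B j ⟩
    linComb (λ i → toℚ (+ D) * q k i) B j  ≡⟨ ∑-cong (λ i → ≡.cong (_* B i j) (D*q≡N k i)) ⟩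
    linComb (toℚVec (N k)) B j             ≡⟨ toℚ-linComb (N k) b j ⟨
    toℚ (ℤΣ.linComb (N k) b j)             ∎)
    where open ≡.≡-Reasoning

  linComb-divMod : ∀ c j → ℤΣ.linComb c A j ≡
    ℤΣ.linComb (λ k → + (c k %ℕ D)) A j ℤ.+ ℤΣ.linComb (ℤΣ.linComb (λ k → c k /ℕ D) N) b j
  linComb-divMod c j = begin
    ℤΣ.linComb c A j
      ≡⟨ ℤΣ.∑-cong (λ k → ≡.cong (ℤ._* A k j) (a≡a%ℕn+[a/ℕn]*n (c k) D)) ⟩
    ℤΣ.linComb (λ k → + e k ℤ.+ t k ℤ.* + D) A j
      ≡⟨ ℤΣ.linComb-distrib-+ (+_ ∘ e) (λ k → t k ℤ.* + D) A j ⟩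
    eA ℤ.+ ℤΣ.linComb (λ k → t k ℤ.* + D) A j
      ≡⟨ ≡.cong (λ w → eA ℤ.+ w) (ℤΣ.∑-cong (λ k → ℤP.*-assoc (t k) (+ D) (A k j))) ⟩
    eA ℤ.+ ℤΣ.linComb t (λ k i → + D ℤ.* A k i) j
      ≡⟨ ≡.cong (λ w → eA ℤ.+ w) (ℤΣ.∑-cong (λ k → ≡.cong (t k ℤ.*_) (D*A≡N·b k j))) ⟩
    eA ℤ.+ ℤΣ.linComb t (λ k → ℤΣ.linComb (N k) b) j
      ≡⟨ ≡.cong (λ w → eA ℤ.+ w) (ℤΣ.linComb-assoc t N b j) ⟨
    eA ℤ.+ ℤΣ.linComb (ℤΣ.linComb t N) b j ∎
    where
    open ≡.≡-Reasoning
    e : Fin m → ℕ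
    e k = c k %ℕ D
    t : Fin m → ℤ
    t k = c k /ℕ D
    eA : ℤ
    eA = ℤΣ.linComb (+_ ∘ e) A j

  coordinates-split : ∀ (e : Fin m → ℤ) (M : ℤVec n) x →
    (∀ j → toℚ (ℤΣ.linComb e A j ℤ.+ ℤΣ.linComb M b j) ≡ linComb x B j) →
    ∀ i → x i ≡ linComb (toℚVec e) q i + toℚ (M i)
  coordinates-split e M x eA+Mb≡xB = spanning⇒injective spans x (λ i → S i + toℚ (M i)) xB≡[S+M]B
    where
    open ≡.≡-Reasoning
    S : ℚVec n
    S = linComb (toℚVec e) q
    xB≡[S+M]B : ∀ j → linComb x B j ≡ linComb (λ i → S i + toℚ (M i)) B j
    xB≡[S+M]B j = begin
      linComb x B j
        ≡⟨ eA+Mb≡xB j ⟨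
      toℚ (ℤΣ.linComb e A j ℤ.+ ℤΣ.linComb M b j)
        ≡⟨ toℚ-+ (ℤΣ.linComb e A j) (ℤΣ.linComb M b j) ⟩
      toℚ (ℤΣ.linComb e A j) + toℚ (ℤΣ.linComb M b j)
        ≡⟨ ≡.cong₂ _+_ (toℚ-linComb e A j) (toℚ-linComb M b j) ⟩
      linComb (toℚVec e) (toℚVec ∘ A) j + MB
        ≡⟨ ≡.cong (_+ MB) (∑-cong (λ k → ≡.cong (toℚ (e k) *_) (A≡qB k j))) ⟩
      linComb (toℚVec e) (λ k → linComb (q k) B) j + MB
        ≡⟨ ≡.cong (_+ MB) (linComb-assoc (toℚVec e) q B j) ⟨
      linComb S B j + MB
        ≡⟨ linComb-distrib-+ S (toℚVec M) B j ⟨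
      linComb (λ i → S i + toℚ (M i)) B j ∎
      where
      MB : ℚ
      MB = linComb (toℚVec M) B j

  linComb-remainders≤threshold : ∀ (e : Fin m → ℕ) → (∀ k → e k ℕ.≤ D) →
    ∀ i → linComb (λ k → toℚ (+ e k)) q i ≤ threshold i
  linComb-remainders≤threshold e e≤D i = ∑-mono-≤ λ k → begin
    toℚ (+ e k) * q k i
      ≤⟨ ℚP.*-monoˡ-≤-nonNeg (toℚ (+ e k)) {{ℚ.nonNegative (0≤toℚ+ (e k))}} (p≤∣p∣ (q k i)) ⟩
    toℚ (+ e k) * ∣ q k i ∣
      ≤⟨ ℚP.*-monoʳ-≤-nonNeg ∣ q k i ∣ {{ℚP.∣-∣-nonNeg (q k i)}} (toℚ-mono-≤ (+≤+ (e≤D k))) ⟩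
    toℚ (+ D) * ∣ q k i ∣ ∎
    where open ℚP.≤-Reasoning

  aboveThreshold⇒inSemigroup : GeneratesℤModule A → (∀ i → b i ∈ᴬ A) →
    ∀ x → (∀ i → threshold i ≤ x i) → (z : ℤVec n) → (∀ j → toℚ (z j) ≡ qComb x b j) →
    InSemigroup A z
  aboveThreshold⇒inSemigroup gen b∈A x threshold≤x z z≡xB =
    inSemigroup-resp A z≡eA+Mb (inSemigroup-+ A (e , λ _ → ≡.refl)
      (inSemigroup-resp A Mb≡∣M∣b (inSemigroup-linComb A (ℤ.∣_∣ ∘ M) b (∈ᴬ⇒inSemigroup ∘ b∈A))))
    where
    c : Fin m → ℤ
    c = proj₁ (gen z)
    e : Fin m → ℕ
    e k = c k %ℕ D
    M : ℤVec n
    M = ℤΣ.linComb (λ k → c k /ℕ D) N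
    z≡eA+Mb : ∀ j → z j ≡ ℤΣ.linComb (+_ ∘ e) A j ℤ.+ ℤΣ.linComb M b j
    z≡eA+Mb j = ≡.trans (proj₂ (gen z) j) (linComb-divMod c j)
    x≡S+M : ∀ i → x i ≡ linComb (λ k → toℚ (+ e k)) q i + toℚ (M i)
    x≡S+M = coordinates-split (+_ ∘ e) M x (λ j → ≡.trans (≡.cong toℚ (≡.sym (z≡eA+Mb j))) (z≡xB j))
    0≤M : ∀ i → + 0 ℤ.≤ M i
    0≤M i = toℚ-cancel-≤ (x≡s+t∧s≤x⇒0≤t (x≡S+M i) (ℚP.≤-trans
      (linComb-remainders≤threshold e (λ k → ℕP.<⇒≤ (n%ℕd<d (c k) D)) i) (threshold≤x i)))
    Mb≡∣M∣b : ∀ j → ℤΣ.linComb M b j ≡ ℤΣ.linComb (+_ ∘ ℤ.∣_∣ ∘ M) b j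
    Mb≡∣M∣b j = ℤΣ.∑-cong (λ i → ≡.cong (ℤ._* b i j) (≡.sym (ℤP.0≤i⇒+∣i∣≡i (0≤M i))))

mainTheorem16 : (n m : ℕ) (A : Fin m → ℤVec n) (b : Fin n → ℤVec n) →
    GeneratesℤModule A →
    zeroV ∈ᴬ A →
    (∀ i → b i ∈ᴬ A) →
    Spans b →
    Σ (Fin n → ℚ) λ r → (∀ i → 0ℚ ≤ r i) ×
      ((x : Fin n → ℚ) → (∀ i → r i ≤ x i) →
       (z : ℤVec n) → (∀ j → toℚ (z j) ≡ qComb x b j) →
       InSemigroup A z)
mainTheorem16 n m A b gen _ b∈A spans =
  threshold A b spans , threshold-nonNeg A b spans , aboveThreshold⇒inSemigroup A b spans gen b∈A
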